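{- Let $S$ be a numerical semigroup that is dimension-$d$ realizable, and suppose that $g = \gcd \mathfrak{s}(S) \geq 2$. Then $S/g = \{ n \in \mathbb{N} : gn \in S\}$ is dimension-$d$ realizable.
   Context: $\mathbb{N} = \{0,1,2,\ldots\}$. A numerical semigroup is an additive subsemigroup of $\mathbb{N}$ containing $0$ whose complement in $\mathbb{N}$ is finite; its Frobenius number $F(S)$ is the largest natural number not in $S$. The set of nonzero small elements is $\mathfrak{s}(S) = \{ n \in S \setminus \{0\} : n < F(S)\}$. For $A \in \mathsf{M}_d(\mathbb{Q})$ (the $d\times d$ rational matrices), $\mathcal{S}(A) = \{ n \in \mathbb{N} : A^n \text{ has all entries in } \mathbb{Z}\}$. A semigroup $S$ is dimension-$d$ realizable if $S = \mathcal{S}(A)$ for some $A \in \mathsf{M}_d(\mathbb{Q})$. -}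

module Defs where

open import Data.Nat using (ℕ; zero; suc; _<_; _≤_; _*_)
open import Data.Nat.Divisibility using (_∣_)
open import Data.Integer using (ℤ)
open import Data.Rational using (ℚ; 0ℚ; 1ℚ; _+_) renaming (_*_ to _*ℚ_)
import Data.Rational as ℚ
open import Data.Fin using (Fin; zero; suc; _≟_)
open import Data.Product using (Σ; ∃; _×_)
open import Data.Empty using (⊥)
open import Relation.Nullary using (¬_; yes; no)
open import Relation.Binary.PropositionalEquality using (_≡_)
open import Function.Bundles using (_⇔_)

Mat : ℕ → Set
Mat d = Fin d → Fin d → ℚ

sumℚ : ∀ {d} → (Fin d → ℚ) → ℚ
sumℚ {zero}  f = 0ℚ
sumℚ {suc d} f = f zero + sumℚ (λ i → f (suc i))

_⊗_ : ∀ {d} → Mat d → Mat d → Mat d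
(A ⊗ B) i j = sumℚ (λ k → A i k *ℚ B k j)

I : ∀ {d} → Mat d
I i j with i ≟ j
... | yes _ = 1ℚ
... | no _  = 0ℚ

_^ᴹ_ : ∀ {d} → Mat d → ℕ → Mat d
A ^ᴹ zero  = I
A ^ᴹ suc n = A ⊗ (A ^ᴹ n)

IsInt : ℚ → Set
IsInt q = ∃ λ (z : ℤ) → q ≡ z ℚ./ 1

𝒮 : ∀ {d} → Mat d → ℕ → Set
𝒮 A n = ∀ i j → IsInt ((A ^ᴹ n) i j)

IsNumericalSemigroup : (ℕ → Set) → Set
IsNumericalSemigroup S =
  S 0 × (∀ m n → S m → S n → S (m Data.Nat.+ n)) × (∃ λ N → ∀ n → N ≤ n → S n)

IsFrobenius : (ℕ → Set) → ℕ → Set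
IsFrobenius S F = ¬ S F × (∀ n → F < n → S n)

-- 𝔰(S) = nonzero elements of S below F(S)
Small : (ℕ → Set) → ℕ → ℕ → Set
Small S F n = S n × ¬ (n ≡ 0) × n < F

-- g is the gcd of the set X (greatest w.r.t. divisibility; gcd ∅ = 0)
IsGcdOf : (ℕ → Set) → ℕ → Set
IsGcdOf X g = (∀ x → X x → g ∣ x) × (∀ c → (∀ x → X x → c ∣ x) → c ∣ g)

Realizable : ℕ → (ℕ → Set) → Set
Realizable d S = Σ (Mat d) λ A → ∀ n → S n ⇔ 𝒮 A n

{-# OPTIONS --safe #-}
-- If S = 𝒮(A) then S/g = 𝒮(A^g), because (A^g)^n = A^(g n).
module Submission where

open import Defs
open import Data.Nat using (ℕ; zero; suc; _+_; _≤_; _*_)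
import Data.Nat.Properties as ℕ
open import Data.Rational using (ℚ; 0ℚ; 1ℚ) renaming (_+_ to _+ℚ_; _*_ to _*ℚ_)
import Data.Rational.Properties as ℚ
open import Algebra.Bundles using (CommutativeRing)
open import Data.Fin using (Fin; zero; suc; _≟_)
open import Data.Product using (_,_)
open import Function.Base using (_∘_)
open import Function.Bundles using (_⇔_; mk⇔; Equivalence)
open import Relation.Nullary using (yes; no)
open import Relation.Binary.PropositionalEquality using (_≡_; refl; sym; trans; cong; cong₂; subst; module ≡-Reasoning)

open import Algebra.Properties.Semiring.Sum (CommutativeRing.semiring ℚ.+-*-commutativeRing)
  using (sum; sum-cong-≗; sum-replicate-zero; ∑-comm; *-distribˡ-sum; *-distribʳ-sum)

sumℚ≡sum : ∀ {d} (f : Fin d → ℚ) → sumℚ f ≡ sum f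
sumℚ≡sum {zero}  f = refl
sumℚ≡sum {suc d} f = cong (f zero +ℚ_) (sumℚ≡sum (f ∘ suc))

infix 4 _≈ᴹ_

_≈ᴹ_ : ∀ {d} → Mat d → Mat d → Set
A ≈ᴹ B = ∀ i j → A i j ≡ B i j

⊗-entry : ∀ {d} (A B : Mat d) i j → (A ⊗ B) i j ≡ sum (λ k → A i k *ℚ B k j)
⊗-entry A B i j = sumℚ≡sum (λ k → A i k *ℚ B k j)

⊗-congˡ : ∀ {d} (A : Mat d) {B C : Mat d} → B ≈ᴹ C → A ⊗ B ≈ᴹ A ⊗ C
⊗-congˡ A {B} {C} B≈C i j = begin
  (A ⊗ B) i j                ≡⟨ ⊗-entry A B i j ⟩
  sum (λ k → A i k *ℚ B k j)  ≡⟨ sum-cong-≗ (λ k → cong (A i k *ℚ_) (B≈C k j)) ⟩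
  sum (λ k → A i k *ℚ C k j)  ≡⟨ sym (⊗-entry A C i j) ⟩
  (A ⊗ C) i j                ∎
  where open ≡-Reasoning

⊗-assoc : ∀ {d} (A B C : Mat d) → (A ⊗ B) ⊗ C ≈ᴹ A ⊗ (B ⊗ C)
⊗-assoc A B C i j = begin
  ((A ⊗ B) ⊗ C) i j
    ≡⟨ ⊗-entry (A ⊗ B) C i j ⟩
  sum (λ k → (A ⊗ B) i k *ℚ C k j)
    ≡⟨ sum-cong-≗ (λ k → cong (_*ℚ C k j) (⊗-entry A B i k)) ⟩
  sum (λ k → sum (λ l → A i l *ℚ B l k) *ℚ C k j)
    ≡⟨ sum-cong-≗ (λ k → *-distribʳ-sum (C k j) (λ l → A i l *ℚ B l k)) ⟩
  sum (λ k → sum (λ l → A i l *ℚ B l k *ℚ C k j))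
    ≡⟨ ∑-comm (λ k l → A i l *ℚ B l k *ℚ C k j) ⟩
  sum (λ l → sum (λ k → A i l *ℚ B l k *ℚ C k j))
    ≡⟨ sum-cong-≗ (λ l → sum-cong-≗ (λ k → ℚ.*-assoc (A i l) (B l k) (C k j))) ⟩
  sum (λ l → sum (λ k → A i l *ℚ (B l k *ℚ C k j)))
    ≡⟨ sum-cong-≗ (λ l → sym (*-distribˡ-sum (A i l) (λ k → B l k *ℚ C k j))) ⟩
  sum (λ l → A i l *ℚ sum (λ k → B l k *ℚ C k j))
    ≡⟨ sum-cong-≗ (λ l → cong (A i l *ℚ_) (sym (⊗-entry B C l j))) ⟩
  sum (λ l → A i l *ℚ (B ⊗ C) l j)
    ≡⟨ sym (⊗-entry A (B ⊗ C) i j) ⟩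
  (A ⊗ (B ⊗ C)) i j
    ∎
  where open ≡-Reasoning

I-suc : ∀ {d} (i k : Fin d) → I (suc i) (suc k) ≡ I i k
I-suc i k with i ≟ k
... | yes _ = refl
... | no _  = refl

sum-I* : ∀ {d} (v : Fin d → ℚ) i → sum (λ k → I i k *ℚ v k) ≡ v i
sum-I* {suc d} v zero = begin
  1ℚ *ℚ v zero +ℚ sum (λ k → 0ℚ *ℚ v (suc k))
    ≡⟨ cong₂ _+ℚ_ (ℚ.*-identityˡ (v zero)) (sum-cong-≗ (ℚ.*-zeroˡ ∘ v ∘ suc)) ⟩
  v zero +ℚ sum {d} (λ _ → 0ℚ)  ≡⟨ cong (v zero +ℚ_) (sum-replicate-zero d) ⟩
  v zero +ℚ 0ℚ                  ≡⟨ ℚ.+-identityʳ (v zero) ⟩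
  v zero                        ∎
  where open ≡-Reasoning
sum-I* {suc d} v (suc i) = begin
  0ℚ *ℚ v zero +ℚ sum (λ k → I (suc i) (suc k) *ℚ v (suc k))
    ≡⟨ cong₂ _+ℚ_ (ℚ.*-zeroˡ (v zero)) (sum-cong-≗ (λ k → cong (_*ℚ v (suc k)) (I-suc i k))) ⟩
  0ℚ +ℚ sum (λ k → I i k *ℚ v (suc k))  ≡⟨ ℚ.+-identityˡ _ ⟩
  sum (λ k → I i k *ℚ v (suc k))        ≡⟨ sum-I* (v ∘ suc) i ⟩
  v (suc i)                             ∎
  where open ≡-Reasoning

I-⊗ : ∀ {d} (B : Mat d) → I ⊗ B ≈ᴹ B
I-⊗ B i j = trans (⊗-entry I B i j) (sum-I* (λ k → B k j) i)

^ᴹ-+ : ∀ {d} (A : Mat d) m n → A ^ᴹ (m + n) ≈ᴹ (A ^ᴹ m) ⊗ (A ^ᴹ n)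
^ᴹ-+ A zero    n i j = sym (I-⊗ (A ^ᴹ n) i j)
^ᴹ-+ A (suc m) n i j =
  trans (⊗-congˡ A (^ᴹ-+ A m n) i j) (sym (⊗-assoc A (A ^ᴹ m) (A ^ᴹ n) i j))

^ᴹ-* : ∀ {d} (A : Mat d) g n → A ^ᴹ (g * n) ≈ᴹ (A ^ᴹ g) ^ᴹ n
^ᴹ-* A g zero    i j = cong (λ m → (A ^ᴹ m) i j) (ℕ.*-zeroʳ g)
^ᴹ-* A g (suc n) i j = begin
  (A ^ᴹ (g * suc n)) i j           ≡⟨ cong (λ m → (A ^ᴹ m) i j) (ℕ.*-suc g n) ⟩
  (A ^ᴹ (g + g * n)) i j           ≡⟨ ^ᴹ-+ A g (g * n) i j ⟩
  ((A ^ᴹ g) ⊗ (A ^ᴹ (g * n))) i j  ≡⟨ ⊗-congˡ (A ^ᴹ g) (^ᴹ-* A g n) i j ⟩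
  ((A ^ᴹ g) ^ᴹ suc n) i j          ∎
  where open ≡-Reasoning

𝒮-^ : ∀ {d} (A : Mat d) g n → 𝒮 (A ^ᴹ g) n ⇔ 𝒮 A (g * n)
𝒮-^ A g n = mk⇔
  (λ int i j → subst IsInt (sym (^ᴹ-* A g n i j)) (int i j))
  (λ int i j → subst IsInt (^ᴹ-* A g n i j) (int i j))

Realizable-quotient : ∀ {d S} → Realizable d S → ∀ g → Realizable d (λ n → S (g * n))
Realizable-quotient (A , S⇔𝒮A) g = A ^ᴹ g , λ n → mk⇔
  (Equivalence.from (𝒮-^ A g n) ∘ Equivalence.to (S⇔𝒮A (g * n)))
  (Equivalence.from (S⇔𝒮A (g * n)) ∘ Equivalence.to (𝒮-^ A g n))

theorem3p2 : (d : ℕ) (S : ℕ → Set) → IsNumericalSemigroup S → Realizable d S →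
    (F g : ℕ) → IsFrobenius S F → IsGcdOf (Small S F) g → 2 ≤ g →
    Realizable d (λ n → S (g * n))
theorem3p2 _ _ _ realizable _ g _ _ _ = Realizable-quotient realizable g
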